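{- Even if the chase of a rule set $\mathcal{R}$ terminates, the chase of every TGD set in $\mathsf{Sing}(\mathcal{R})$ may not.
   Context: Rules are function- and constant-free first-order formulas of two kinds: tuple generating dependencies (TGDs) $\forall \vec{x},\vec{y}.(\beta[\vec{x},\vec{y}] \to \exists \vec{w}.\eta[\vec{x},\vec{w}])$ and equality generating dependencies (EGDs) $\forall \vec{x}.(\beta[\vec{x}] \to x \approx y)$ with $x,y \in \vec{x}$, where $\beta,\eta$ are non-empty conjunctions of equality-free atoms. The (non-oblivious, Skolem) chase on an ontology $\langle\mathcal{R},\mathcal{F}\rangle$ starts from the fact set $\mathcal{F}$; a TGD with body match $\sigma$ is applicable if no extension of $\sigma$ maps its head into the current set and then adds its head with existential variables $w$ replaced by Skolem terms $f_w(\sigma(\vec{x}))$; an EGD with body match $\sigma$ and $\sigma(x)\neq\sigma(y)$ merges the two terms (deeper into shallower by a fixed total order compatible with depth). Chase sequences must be fair. The chase of a rule set $\mathcal{R}$ terminates if for every fact set $\mathcal{F}$ all chase sequences of $\langle\mathcal{R},\mathcal{F}\rangle$ are finite. A singularisation of a conjunction of atoms $\beta$ is obtained by choosing, for each variable $x$ of $\beta$, one of its occurrences to keep, replacing every other ($i$-th) occurrence of $x$ by a fresh variable $x_i$, and adding the atom $\mathsf{EQ}(x,x_i)$ for each such fresh variable, where $\mathsf{EQ}$ is a fresh binary predicate. A singularisation of a TGD $\beta\to\exists\vec{w}.\eta$ is $\beta'\to\exists\vec{w}.\eta$ and of an EGD $\beta\to x\approx y$ is $\beta'\to\mathsf{EQ}(x,y)$,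 with $\beta'$ a singularisation of $\beta$. $\mathsf{Sing}(\mathcal{R})$ is the set of all TGD sets containing exactly one singularisation of each rule of $\mathcal{R}$, together with the reflexivity rules $P(x_1,\ldots,x_n)\to\bigwedge_i\mathsf{EQ}(x_i,x_i)$ for every predicate $P\neq\approx$ of $\mathcal{R}$, symmetry $\mathsf{EQ}(x,y)\to\mathsf{EQ}(y,x)$, and transitivity $\mathsf{EQ}(x,y)\wedge\mathsf{EQ}(y,z)\to\mathsf{EQ}(x,z)$. The claim means: there is a rule set whose chase terminates while the chase of no TGD set in $\mathsf{Sing}(\mathcal{R})$ terminates. -}

module Defs where

open import Data.Nat using (ℕ; zero; suc; _+_; _<_; _⊔_)
open import Data.Nat.Properties using (_≟_)
open import Data.Bool using (Bool; true; false; not)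
open import Data.List using (List; []; _∷_; _++_; map; concatMap; filter; zip; length; upTo)
open import Data.List.Membership.Propositional using (_∈_; _∉_)
open import Data.List.Membership.DecPropositional _≟_ using (_∈?_)
open import Data.List.Relation.Unary.All using (All)
open import Data.List.Relation.Unary.Unique.Propositional using (Unique)
open import Data.List.Relation.Binary.Pointwise using (Pointwise)
open import Data.List.NonEmpty using ()
open import Data.Product using (Σ; ∃; _×_; _,_; proj₁; proj₂)
open import Data.Sum using (_⊎_)
open import Relation.Nullary using (¬_; does)
open import Relation.Binary.PropositionalEquality using (_≡_; _≢_)

-- Atoms.  A predicate is identified by its name (a natural number)
-- together with its arity (the length of the argument list).

record Atom (A : Set) : Set where
  constructor atom
  field
    pred : ℕ
    args : List A
open Atom public

mapAtom : {A B : Set} → (A → B) → Atom A → Atom B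
mapAtom f (atom p as) = atom p (map f as)

-- rule atoms are over variables (natural numbers): function- and constant-free
VAtom : Set
VAtom = Atom ℕ

varsOf : List VAtom → List ℕ
varsOf = concatMap args

record TGD : Set where
  constructor mkTGD
  field
    body : List VAtom
    exs  : List ℕ
    head : List VAtom
open TGD public

record EGD : Set where
  constructor mkEGD
  field
    ebody : List VAtom
    ex    : ℕ
    ey    : ℕ
open EGD public

data Rule : Set where
  tgd : TGD → Rule
  egd : EGD → Rule

NonEmpty : {A : Set} → List A → Set
NonEmpty xs = Σ _ λ y → Σ _ λ ys → xs ≡ y ∷ ys

WFRule : Rule → Set
WFRule (tgd (mkTGD b w h)) =
  NonEmpty b × NonEmpty h
  × (∀ v → v ∈ w → v ∉ varsOf b)
  × (∀ v → v ∈ varsOf h → v ∈ varsOf b ⊎ v ∈ w)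
WFRule (egd (mkEGD b x y)) = NonEmpty b × x ∈ varsOf b × y ∈ varsOf b

ruleVars : Rule → List ℕ
ruleVars (tgd (mkTGD b w h)) = varsOf b ++ w ++ varsOf h
ruleVars (egd (mkEGD b x y)) = varsOf b ++ x ∷ y ∷ []

ruleAtoms : Rule → List VAtom
ruleAtoms (tgd (mkTGD b w h)) = b ++ h
ruleAtoms (egd (mkEGD b x y)) = b

-- Terms: constants and Skolem terms f_w(t⃗), where the Skolem function
-- symbol f_w is determined by the TGD and its existential variable w.

data Term : Set where
  con : ℕ → Term
  sk  : TGD → ℕ → List Term → Term

mutual
  depth : Term → ℕ
  depth (con _) = 0
  depth (sk _ _ ts) = suc (depthL ts)

  depthL : List Term → ℕ
  depthL [] = 0
  depthL (t ∷ ts) = depth t ⊔ depthL ts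

DepthCompatible : (Term → Term → Set) → Set
DepthCompatible _≺_ = ∀ s t → depth s < depth t → s ≺ t

Fact : Set
Fact = Atom Term

FactSet : Set
FactSet = List Fact

IsDatabase : FactSet → Set
IsDatabase F = All (λ a → All (λ t → Σ ℕ λ c → t ≡ con c) (args a)) F

_≈ₛ_ : FactSet → FactSet → Set
F ≈ₛ G = ∀ a → (a ∈ F → a ∈ G) × (a ∈ G → a ∈ F)

Subst : Set
Subst = ℕ → Term

MapsInto : Subst → List VAtom → FactSet → Set
MapsInto σ β F = All (λ a → mapAtom σ a ∈ F) β

Applicable : Rule → Subst → FactSet → Set
Applicable (tgd (mkTGD b w h)) σ F =
  MapsInto σ b F
  × ¬ (Σ Subst λ σ' → (∀ v → v ∈ varsOf b → σ' v ≡ σ v) × MapsInto σ' h F)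
Applicable (egd (mkEGD b x y)) σ F = MapsInto σ b F × σ x ≢ σ y

frontier : TGD → List ℕ
frontier (mkTGD b w h) = filter (λ v → not? v) (varsOf h)
  where
  open import Relation.Nullary.Decidable using (¬?)
  not? : ∀ v → _
  not? v = ¬? (v ∈? w)

skolemExt : TGD → Subst → Subst
skolemExt r σ v with does (v ∈? exs r)
... | true  = sk r v (map σ (frontier r))
... | false = σ v

data Rep (t s : Term) : Term → Term → Set where
  here : Rep t s t s
  rcon : ∀ {n} → t ≢ con n → Rep t s (con n) (con n)
  rsk  : ∀ {r w us vs} → t ≢ sk r w us → Pointwise (Rep t s) us vs →
         Rep t s (sk r w us) (sk r w vs)

Step : (Term → Term → Set) → List Rule → FactSet → FactSet → (Term → Term) → Set
Step _≺_ R F F' ρ = Σ Rule λ r → Σ Subst λ σ → r ∈ R × Applicable r σ F × Res r σ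
  where
  Res : Rule → Subst → Set
  Res (tgd t) σ = (∀ u → ρ u ≡ u)
                  × F' ≈ₛ (F ++ map (mapAtom (skolemExt t σ)) (head t))
  Res (egd (mkEGD b x y)) σ =
    Σ Term λ s → Σ Term λ t →
      ((s ≡ σ x × t ≡ σ y) ⊎ (s ≡ σ y × t ≡ σ x))
      × s ≺ t
      × (∀ u → Rep t s u (ρ u))
      × F' ≈ₛ map (mapAtom ρ) F

-- accumulated substitution of steps i, …, i+n-1
accSub : (ℕ → Term → Term) → ℕ → ℕ → Term → Term
accSub sub i zero u = u
accSub sub i (suc n) u = sub (i + n) (accSub sub i n u)

record InfiniteChase (_≺_ : Term → Term → Set) (R : List Rule) (F : FactSet) : Set where
  field
    seq   : ℕ → FactSet
    sub   : ℕ → (Term → Term)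
    start : seq 0 ≡ F
    step  : ∀ i → Step _≺_ R (seq i) (seq (suc i)) (sub i)
    fair  : ∀ i r σ → r ∈ R → Applicable r σ (seq i) →
            Σ ℕ λ n → ¬ Applicable r (λ v → accSub sub i n (σ v)) (seq (i + n))

Terminates : (Term → Term → Set) → List Rule → Set
Terminates _≺_ R = ∀ F → IsDatabase F → ¬ InfiniteChase _≺_ R F

FreshEQ : ℕ → List Rule → Set
FreshEQ e R = ∀ r → r ∈ R → ∀ a → a ∈ ruleAtoms r → ¬ (pred a ≡ e × length (args a) ≡ 2)

SameShape : VAtom → VAtom → Set
SameShape a b = pred a ≡ pred b × length (args a) ≡ length (args b)

EQatom : ℕ → ℕ → ℕ → VAtom
EQatom e x y = atom e (x ∷ y ∷ [])

eqAtoms : ℕ → List (ℕ × ℕ) → List VAtom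
eqAtoms e [] = []
eqAtoms e ((x , y) ∷ ps) with does (x ≟ y)
... | true  = eqAtoms e ps
... | false = EQatom e x y ∷ eqAtoms e ps

-- β' is a singularisation of the body β (of a rule with variables vs):
-- γ is β where each occurrence either keeps its variable or gets a fresh
-- variable; every variable is kept exactly once, fresh variables are
-- pairwise distinct; β' = γ ∧ ⋀ EQ(x, xᵢ)
SingBody : ℕ → List ℕ → List VAtom → List VAtom → Set
SingBody e vs β β' = Σ (List VAtom) λ γ →
  Pointwise SameShape β γ
  × Pointwise (λ x g → g ≡ x ⊎ g ∉ vs) (varsOf β) (varsOf γ)
  × Unique (varsOf γ)
  × (∀ x → x ∈ varsOf β → x ∈ varsOf γ)
  × β' ≡ γ ++ eqAtoms e (zip (varsOf β) (varsOf γ))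

SingRule : ℕ → Rule → Rule → Set
SingRule e r@(tgd (mkTGD b w h)) r' =
  Σ (List VAtom) λ b' → SingBody e (ruleVars r) b b' × r' ≡ tgd (mkTGD b' w h)
SingRule e r@(egd (mkEGD b x y)) r' =
  Σ (List VAtom) λ b' → SingBody e (ruleVars r) b b'
    × r' ≡ tgd (mkTGD b' [] (EQatom e x y ∷ []))

predsOf : List Rule → List (ℕ × ℕ)
predsOf R = concatMap (λ r → map (λ a → pred a , length (args a)) (ruleAtoms r)) R

reflRule : ℕ → ℕ × ℕ → Rule
reflRule e (p , n) =
  tgd (mkTGD (atom p (upTo n) ∷ []) [] (map (λ i → EQatom e i i) (upTo n)))

symRule : ℕ → Rule
symRule e = tgd (mkTGD (EQatom e 0 1 ∷ []) [] (EQatom e 1 0 ∷ []))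

transRule : ℕ → Rule
transRule e = tgd (mkTGD (EQatom e 0 1 ∷ EQatom e 1 2 ∷ []) [] (EQatom e 0 2 ∷ []))

IsSing : ℕ → List Rule → List Rule → Set
IsSing e R S = Σ (List Rule) λ L →
  Pointwise (SingRule e) R L
  × S ≡ L ++ map (reflRule e) (predsOf R) ++ symRule e ∷ transRule e ∷ []

-- Take R = { P(x,x) → ∃y z. P(x,y) ∧ P(y,z) ,  P(x,y) → x ≈ y }.  Its TGD is never
-- applicable, because a match of P(x,x) already satisfies the head with y = z = x, so a
-- chase of R only merges constants of the database and stops after at most |adom F| steps.
-- Singularisation turns the TGD body into P(x,x′) ∧ EQ(x,x′) or P(x′,x) ∧ EQ(x,x′), while
-- the singularised EGD and symmetry derive EQ(s,t) and EQ(t,s) from every fact P(s,t).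
-- From P(a,b) the TGD therefore fires at a (resp. b), producing P(x,y) ∧ P(y,z), then at
-- the new null y (resp. z), and so on forever.  A fair infinite chase is obtained by a
-- round-robin scheduler, which works because only finitely many triggers of a fact set
-- matter and their applicability is decidable.

module Submission where

open import Defs
open import Data.Empty using (⊥; ⊥-elim)
open import Data.Fin using (toℕ)
open import Data.Fin.Properties using (pigeonhole)
open import Data.List using (List; []; _∷_; _++_; map; concatMap; length; lookup)
open import Data.List.Properties using (≡-dec; ∷-dec; length-++; map-cong-local)
open import Data.List.Membership.Propositional using (_∈_; _∉_; lose; find)
open import Data.List.Membership.Propositional.Properties
  using (∈-map⁺; ∈-map⁻; ∈-++⁺ˡ; ∈-++⁺ʳ; ∈-++⁻; ∈-concatMap⁺; ∈-concatMap⁻)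
import Data.List.Membership.DecPropositional as DecMembership
open import Data.List.Relation.Binary.Subset.Propositional using (_⊆_)
open import Data.List.Relation.Unary.Any as Any using (Any; here; there; any?)
open import Data.List.Relation.Unary.Any.Properties using (lookup-index)
open import Data.List.Relation.Unary.All as All using (All; []; _∷_; all?)
open import Data.List.Relation.Unary.All.Properties using (¬Any⇒All¬)
open import Data.List.Relation.Unary.AllPairs using (_∷_)
open import Data.List.Relation.Binary.Pointwise using ([]; _∷_)
open import Data.Nat as ℕ using (ℕ; zero; suc; _+_; _≤_; _<_; s≤s)
open import Data.Nat.Properties
  using ( +-identityʳ; +-suc; +-assoc; ≤-refl; ≤-trans; ≤-pred; m≤n+m; m≤n⇒m<n∨m≡n; n<1+n; 1+n≰n
        ; m≤m⊔n; m≤n⊔m; ⊔-identityʳ)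
open import Data.Product using (Σ; _×_; _,_; proj₁; proj₂)
open import Data.Unit using (⊤; tt)
import Data.Sum as Sum
open import Data.Sum using (_⊎_; inj₁; inj₂)
open import Function using (_∘_)
open import Relation.Unary using (Decidable)
open import Relation.Nullary using (¬_; Dec; yes; no)
open import Relation.Nullary.Decidable using (_×-dec_; _⊎-dec_; ¬?; map′; True; toWitness)
open import Relation.Binary.Definitions using (DecidableEquality; Irreflexive)
open import Relation.Binary.Structures using (IsStrictTotalOrder)
open import Relation.Binary.PropositionalEquality
  using (_≡_; _≢_; refl; sym; trans; cong; subst; subst₂)

≡-dec-Atom : {A : Set} → DecidableEquality A → DecidableEquality (Atom A)
≡-dec-Atom _≟_ (atom p as) (atom q bs) =
  map′ (λ { (refl , refl) → refl }) (λ { refl → refl , refl }) (p ℕ.≟ q ×-dec ≡-dec _≟_ as bs)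

≡-dec-TGD : DecidableEquality TGD
≡-dec-TGD (mkTGD b w h) (mkTGD b′ w′ h′) =
  map′ (λ { (refl , refl , refl) → refl }) (λ { refl → refl , refl , refl })
       (≡-dec vatom? b b′ ×-dec ≡-dec ℕ._≟_ w w′ ×-dec ≡-dec vatom? h h′)
  where
  vatom? : DecidableEquality VAtom
  vatom? = ≡-dec-Atom ℕ._≟_

mutual
  ≡-dec-Term : DecidableEquality Term
  ≡-dec-Term (con m) (con n) = map′ (cong con) (λ { refl → refl }) (m ℕ.≟ n)
  ≡-dec-Term (con _) (sk _ _ _) = no λ ()
  ≡-dec-Term (sk _ _ _) (con _) = no λ ()
  ≡-dec-Term (sk r w ts) (sk r′ w′ ts′) =
    map′ (λ { (refl , refl , refl) → refl }) (λ { refl → refl , refl , refl })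
         (≡-dec-TGD r r′ ×-dec w ℕ.≟ w′ ×-dec ≡-dec-Terms ts ts′)

  ≡-dec-Terms : DecidableEquality (List Term)
  ≡-dec-Terms [] [] = yes refl
  ≡-dec-Terms [] (_ ∷ _) = no λ ()
  ≡-dec-Terms (_ ∷ _) [] = no λ ()
  ≡-dec-Terms (t ∷ ts) (u ∷ us) = ∷-dec (≡-dec-Term t u) (≡-dec-Terms ts us)

open DecMembership ℕ._≟_ using () renaming (_∈?_ to _∈ℕ?_)
open DecMembership ≡-dec-Term using () renaming (_∈?_ to _∈Term?_)
open DecMembership (≡-dec-Atom ≡-dec-Term) using () renaming (_∈?_ to _∈Fact?_)
open DecMembership ≡-dec-TGD using () renaming (_∈?_ to _∈TGD?_)

adom : FactSet → List Term
adom = concatMap args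

module _ {A : Set} where

  ∈-concatArgs⁺ : {u : A} {a : Atom A} {as : List (Atom A)} →
                  u ∈ args a → a ∈ as → u ∈ concatMap args as
  ∈-concatArgs⁺ u∈a a∈as = ∈-concatMap⁺ args (Any.map (λ { refl → u∈a }) a∈as)

  ∈-concatArgs⁻ : {u : A} (as : List (Atom A)) → u ∈ concatMap args as →
                  Σ (Atom A) λ a → a ∈ as × u ∈ args a
  ∈-concatArgs⁻ as u∈ = find (∈-concatMap⁻ args {xs = as} u∈)

adom-++⁻ : ∀ F G {u} → u ∈ adom (F ++ G) → u ∈ adom F ⊎ u ∈ adom G
adom-++⁻ F G u∈ with ∈-concatArgs⁻ (F ++ G) u∈
... | g , g∈ , u∈g = Sum.map (∈-concatArgs⁺ u∈g) (∈-concatArgs⁺ u∈g) (∈-++⁻ F g∈)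

image∈adom : ∀ {σ β F v} → MapsInto σ β F → v ∈ varsOf β → σ v ∈ adom F
image∈adom {σ} {β} mi v∈ with ∈-concatArgs⁻ β v∈
... | atom p vs , a∈ , v∈a = ∈-concatArgs⁺ (∈-map⁺ σ v∈a) (All.lookup mi a∈)

mapAtom-cong-local : ∀ {f g : Subst} (a : VAtom) → (∀ v → v ∈ args a → f v ≡ g v) →
                     mapAtom f a ≡ mapAtom g a
mapAtom-cong-local (atom p vs) f≗g = cong (atom p) (map-cong-local (All.tabulate (f≗g _)))

MapsInto-cong : ∀ {σ τ} β F → (∀ v → v ∈ varsOf β → σ v ≡ τ v) →
                MapsInto σ β F → MapsInto τ β F
MapsInto-cong β F σ≗τ mi = All.tabulate λ {a} a∈ →
  subst (_∈ F) (mapAtom-cong-local a λ v v∈ → σ≗τ v (∈-concatArgs⁺ v∈ a∈)) (All.lookup mi a∈)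

maps? : ∀ σ β F → Dec (MapsInto σ β F)
maps? σ β F = all? (λ a → mapAtom σ a ∈Fact? F) β

WellScoped : TGD → Set
WellScoped t = All (_∉ varsOf (body t)) (exs t)
             × All (λ v → v ∈ varsOf (body t) ⊎ v ∈ exs t) (varsOf (head t))

wellScoped? : ∀ t → Dec (WellScoped t)
wellScoped? t = all? (λ v → ¬? (v ∈ℕ? varsOf (body t))) (exs t)
          ×-dec all? (λ v → v ∈ℕ? varsOf (body t) ⊎-dec v ∈ℕ? exs t) (varsOf (head t))

wellScoped : ∀ t → {True (wellScoped? t)} → WellScoped t
wellScoped t {ok} = toWitness ok

Satisfied : TGD → Subst → FactSet → Set
Satisfied t σ F =
  Σ Subst λ σ′ → (∀ v → v ∈ varsOf (body t) → σ′ v ≡ σ v) × MapsInto σ′ (head t) F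

Assignment : Set
Assignment = List (ℕ × Term)

-- Unassigned variables are sent to the junk value con 0.
valueIn : Assignment → Subst
valueIn [] v = con 0
valueIn ((u , d) ∷ α) v with u ℕ.≟ v
... | yes _ = d
... | no _ = valueIn α v

assignments : List ℕ → List Term → List Assignment
assignments [] D = [] ∷ []
assignments (v ∷ vs) D = concatMap (λ d → map ((v , d) ∷_) (assignments vs D)) D

assignments-complete : ∀ vs D (g : Subst) → (∀ v → v ∈ vs → g v ∈ D) →
  Σ Assignment λ α → α ∈ assignments vs D × (∀ v → v ∈ vs → valueIn α v ≡ g v)
assignments-complete [] D g g∈D = [] , here refl , λ v ()
assignments-complete (v ∷ vs) D g g∈D with assignments-complete vs D g (λ u u∈ → g∈D u (there u∈))
... | α , α∈ , α≗g =
  (v , g v) ∷ α , ∈-concatMap⁺ _ (Any.map (λ { refl → ∈-map⁺ _ α∈ }) (g∈D v (here refl))) , agrees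
  where
  agrees : ∀ u → u ∈ v ∷ vs → valueIn ((v , g v) ∷ α) u ≡ g u
  agrees u u∈ with v ℕ.≟ u | u∈
  ... | yes refl | _ = refl
  ... | no v≢u | here refl = ⊥-elim (v≢u refl)
  ... | no _ | there u∈vs = α≗g u u∈vs

extendBy : TGD → Subst → Assignment → Subst
extendBy t σ α v with v ∈ℕ? exs t
... | yes _ = valueIn α v
... | no _ = σ v

extendBy-body : ∀ {t} → WellScoped t → ∀ σ α {v} → v ∈ varsOf (body t) → extendBy t σ α v ≡ σ v
extendBy-body {t} ws σ α {v} vb with v ∈ℕ? exs t
... | yes ve = ⊥-elim (All.lookup (proj₁ ws) ve vb)
... | no _ = refl

clampTo : FactSet → Term → Term
clampTo F u with u ∈Term? adom F
... | yes _ = u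
... | no _ = con 0

clampTo-∈ : ∀ F u → clampTo F u ∈ con 0 ∷ adom F
clampTo-∈ F u with u ∈Term? adom F
... | yes u∈ = there u∈
... | no _ = here refl

clampTo-adom : ∀ F {u} → u ∈ adom F → clampTo F u ≡ u
clampTo-adom F {u} u∈ with u ∈Term? adom F
... | yes _ = refl
... | no u∉ = ⊥-elim (u∉ u∈)

-- A witness of satisfaction may be assumed to send the existential variables into
-- adom F ∪ {con 0}, so finitely many candidates suffice.
satisfied? : ∀ t → WellScoped t → ∀ σ F → Dec (Satisfied t σ F)
satisfied? t ws σ F
  with any? (λ α → maps? (extendBy t σ α) (head t) F) (assignments (exs t) (con 0 ∷ adom F))
... | yes found = let α , _ , mi = find found in yes (extendBy t σ α , (λ v → extendBy-body ws σ α) , mi)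
... | no none = no λ (σ′ , σ′≗σ , mi) → none (candidate σ′ σ′≗σ mi)
  where
  candidate : ∀ σ′ → (∀ v → v ∈ varsOf (body t) → σ′ v ≡ σ v) → MapsInto σ′ (head t) F →
              Any (λ α → MapsInto (extendBy t σ α) (head t) F) (assignments (exs t) (con 0 ∷ adom F))
  candidate σ′ σ′≗σ mi
    with assignments-complete (exs t) (con 0 ∷ adom F) (clampTo F ∘ σ′) (λ v _ → clampTo-∈ F (σ′ v))
  ... | α , α∈ , α≗clamped = lose α∈ (MapsInto-cong (head t) F agree mi)
    where
    agree : ∀ v → v ∈ varsOf (head t) → σ′ v ≡ extendBy t σ α v
    agree v vh with v ∈ℕ? exs t
    ... | yes ve = sym (trans (α≗clamped v ve) (clampTo-adom F (image∈adom mi vh)))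
    ... | no v∉ = Sum.[ σ′≗σ v , (λ ve → ⊥-elim (v∉ ve)) ] (All.lookup (proj₂ ws) vh)

applicable? : ∀ t → WellScoped t → ∀ σ F → Dec (Applicable (tgd t) σ F)
applicable? t ws σ F = maps? σ (body t) F ×-dec ¬? (satisfied? t ws σ F)

applicable-cong : ∀ t {σ τ} F → (∀ v → v ∈ varsOf (body t) → σ v ≡ τ v) →
                  Applicable (tgd t) σ F → Applicable (tgd t) τ F
applicable-cong t F σ≗τ (mi , unsat) =
  MapsInto-cong (body t) F σ≗τ mi ,
  λ (σ′ , σ′≗τ , mh) → unsat (σ′ , (λ v vb → trans (σ′≗τ v vb) (sym (σ≗τ v vb))) , mh)

produced : TGD → Subst → FactSet
produced t σ = map (mapAtom (skolemExt t σ)) (head t)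

skolemExt-body : ∀ {t} → WellScoped t → ∀ σ {v} → v ∈ varsOf (body t) → skolemExt t σ v ≡ σ v
skolemExt-body {t} ws σ {v} vb with v ∈ℕ? exs t
... | yes ve = ⊥-elim (All.lookup (proj₁ ws) ve vb)
... | no _ = refl

satisfied-after-firing : ∀ t → WellScoped t → ∀ {σ τ} F → (∀ v → v ∈ varsOf (body t) → τ v ≡ σ v) →
                         Satisfied t σ (F ++ produced t τ)
satisfied-after-firing t ws {τ = τ} F τ≗σ =
  skolemExt t τ , (λ v vb → trans (skolemExt-body ws τ vb) (τ≗σ v vb)) ,
  All.tabulate (λ a∈ → ∈-++⁺ʳ F (∈-map⁺ _ a∈))

record Eventually (P : ℕ → Set) (i : ℕ) : Set where
  constructor eventually
  field
    delay : ℕ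
    holds : P (i + delay)

module _ {P : ℕ → Set} where

  now : ∀ {i} → P i → Eventually P i
  now {i} p = eventually 0 (subst P (sym (+-identityʳ i)) p)

  later : ∀ {i} → Eventually P (suc i) → Eventually P i
  later {i} (eventually k p) = eventually (suc k) (subst P (sym (+-suc i k)) p)

  laterBy : ∀ {i} k → Eventually P (i + k) → Eventually P i
  laterBy {i} k (eventually k′ p) = eventually (k + k′) (subst P (+-assoc i k k′) p)

ActiveTrigger : List TGD → FactSet → Set
ActiveTrigger ts F = Σ TGD λ t → Σ Subst λ σ → t ∈ ts × Applicable (tgd t) σ F

Preserves : (FactSet → Set) → TGD → Set
Preserves Inv t = ∀ F σ → Inv F → Applicable (tgd t) σ F → Inv (F ++ produced t σ)

accSub-id : ∀ i n u → accSub (λ _ u → u) i n u ≡ u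
accSub-id i zero u = refl
accSub-id i (suc n) u = accSub-id i n u

-- The chase is scheduled round-robin: a queue holds the triggers of the fact set at
-- the last refill; each step fires the first active trigger of the queue and drops
-- everything before it, and the queue is refilled once nothing in it is active.
module FairChase (ts : List TGD) (scoped : All WellScoped ts) (Inv : FactSet → Set)
  (preserves : All (Preserves Inv) ts) (progress : ∀ F → Inv F → ActiveTrigger ts F)
  (F₀ : FactSet) (inv₀ : Inv F₀) where

  Trigger : Set
  Trigger = TGD × Assignment

  Active : FactSet → Trigger → Set
  Active F (t , α) = t ∈ ts × Applicable (tgd t) (valueIn α) F

  active? : ∀ F c → Dec (Active F c)
  active? F (t , α) with t ∈TGD? ts
  ... | no t∉ = no (t∉ ∘ proj₁)
  ... | yes t∈ = map′ (t∈ ,_) proj₂ (applicable? t (All.lookup scoped t∈) (valueIn α) F)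

  triggers : FactSet → List Trigger
  triggers F = concatMap (λ t → map (t ,_) (assignments (varsOf (body t)) (con 0 ∷ adom F))) ts

  triggers-complete : ∀ {t σ F} → t ∈ ts → MapsInto σ (body t) F →
    Σ Assignment λ α → (t , α) ∈ triggers F × (∀ v → v ∈ varsOf (body t) → valueIn α v ≡ σ v)
  triggers-complete {t} {σ} {F} t∈ mi =
    let α , α∈ , α≗σ = assignments-complete (varsOf (body t)) (con 0 ∷ adom F) σ
                         (λ v vb → there (image∈adom mi vb))
    in α , ∈-concatMap⁺ _ (Any.map (λ { refl → ∈-map⁺ _ α∈ }) t∈) , α≗σ

  some-trigger-active : ∀ F → Inv F → Any (Active F) (triggers F)
  some-trigger-active F inv =
    let t , σ , t∈ , app = progress F inv
        α , α∈ , α≗σ = triggers-complete t∈ (proj₁ app)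
    in lose α∈ (t∈ , applicable-cong t F (λ v vb → sym (α≗σ v vb)) app)

  inactive⇒inapplicable : ∀ {F t α} σ → t ∈ ts → (∀ v → v ∈ varsOf (body t) → valueIn α v ≡ σ v) →
                          ¬ Active F (t , α) → ¬ Applicable (tgd t) σ F
  inactive⇒inapplicable {t = t} σ t∈ α≗σ inactive app =
    inactive (t∈ , applicable-cong t _ (λ v vb → sym (α≗σ v vb)) app)

  record FirstActive (F : FactSet) (queue : List Trigger) : Set where
    field
      before : List Trigger
      trigger : Trigger
      after : List Trigger
      split : queue ≡ before ++ trigger ∷ after
      active : Active F trigger
      before-inactive : All (¬_ ∘ Active F) before

  firstActive : ∀ F queue → Any (Active F) queue → FirstActive F queue
  firstActive F (c ∷ queue) pending with active? F c | pending
  ... | yes c-active | _ = record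
    { before = [] ; trigger = c ; after = queue ; split = refl ; active = c-active ; before-inactive = [] }
  ... | no c-inactive | here c-active = ⊥-elim (c-inactive c-active)
  ... | no c-inactive | there pending′ =
    let open FirstActive (firstActive F queue pending′) in record
    { before = c ∷ before ; trigger = trigger ; after = after ; split = cong (c ∷_) split
    ; active = active ; before-inactive = c-inactive ∷ before-inactive }

  requeue : ∀ F → Inv F → List Trigger → Σ (List Trigger) (Any (Active F))
  requeue F inv queue with any? (active? F) queue
  ... | yes pending = queue , pending
  ... | no _ = triggers F , some-trigger-active F inv

  requeue-cases : ∀ F inv queue → proj₁ (requeue F inv queue) ≡ queue
    ⊎ (proj₁ (requeue F inv queue) ≡ triggers F × All (¬_ ∘ Active F) queue)
  requeue-cases F inv queue with any? (active? F) queue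
  ... | yes _ = inj₁ refl
  ... | no none = inj₂ (refl , ¬Any⇒All¬ queue none)

  record State : Set where
    field
      facts : FactSet
      queue : List Trigger
      invariant : Inv facts
      pending : Any (Active facts) queue
  open State

  fired : (s : State) → FirstActive (facts s) (queue s)
  fired s = firstActive (facts s) (queue s) (pending s)

  firedFacts : State → FactSet
  firedFacts s = let t , α = FirstActive.trigger (fired s) in facts s ++ produced t (valueIn α)

  firedInvariant : ∀ s → Inv (firedFacts s)
  firedInvariant s = let t∈ , app = FirstActive.active (fired s) in
    All.lookup preserves t∈ (facts s) _ (invariant s) app

  nextQueue : ∀ s → Σ (List Trigger) (Any (Active (firedFacts s)))
  nextQueue s = requeue (firedFacts s) (firedInvariant s) (FirstActive.after (fired s))

  state : ℕ → State
  state zero = record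
    { facts = F₀ ; queue = triggers F₀ ; invariant = inv₀ ; pending = some-trigger-active F₀ inv₀ }
  state (suc i) = record
    { facts = firedFacts s ; queue = proj₁ (nextQueue s) ; invariant = firedInvariant s
    ; pending = proj₂ (nextQueue s) }
    where s = state i

  chaseSeq : ℕ → FactSet
  chaseSeq i = facts (state i)

  chaseStep : ∀ {_≺_} i → Step _≺_ (map tgd ts) (chaseSeq i) (chaseSeq (suc i)) (λ u → u)
  chaseStep i = let t , α = FirstActive.trigger (fired (state i))
                    t∈ , app = FirstActive.active (fired (state i))
                in tgd t , valueIn α , ∈-map⁺ tgd t∈ , app , (λ _ → refl) , λ _ → (λ f∈ → f∈) , λ f∈ → f∈

  chaseSeq-mono : ∀ i k {f} → f ∈ chaseSeq i → f ∈ chaseSeq (i + k)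
  chaseSeq-mono i zero f∈ rewrite +-identityʳ i = f∈
  chaseSeq-mono i (suc k) f∈ rewrite +-suc i k = ∈-++⁺ˡ (chaseSeq-mono i k f∈)

  remaining : ℕ → List Trigger
  remaining i = FirstActive.after (fired (state i))

  remaining-shorter : ∀ i n → length (queue (state i)) ≤ suc n → length (remaining i) ≤ n
  remaining-shorter i n ≤1+n = ≤-pred (≤-trans (m≤n+m _ (length before)) (subst (_≤ suc n) length-split ≤1+n))
    where
    open FirstActive (fired (state i))
    length-split : length (queue (state i)) ≡ length before + suc (length after)
    length-split = trans (cong length split) (length-++ before)

  queue-nonempty : ∀ i → ¬ length (queue (state i)) ≤ 0
  queue-nonempty i = Any-nonempty (pending (state i))
    where
    Any-nonempty : ∀ {P : Trigger → Set} {xs} → Any P xs → ¬ length xs ≤ 0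
    Any-nonempty (here _) ()
    Any-nonempty (there _) ()

  Refilled : ℕ → Set
  Refilled i = queue (state i) ≡ triggers (chaseSeq i)

  eventually-refilled : ∀ n i → length (queue (state i)) ≤ n → Eventually Refilled i
  eventually-refilled zero i ≤0 = ⊥-elim (queue-nonempty i ≤0)
  eventually-refilled (suc n) i ≤1+n with requeue-cases _ (firedInvariant (state i)) (remaining i)
  ... | inj₂ (refilled , _) = later (now refilled)
  ... | inj₁ kept =
    later (eventually-refilled n (suc i) (subst (λ q → length q ≤ n) (sym kept) (remaining-shorter i n ≤1+n)))

  Deactivated : TGD → Subst → ℕ → Set
  Deactivated t σ i = ¬ Applicable (tgd t) σ (chaseSeq i)

  queued-eventually-deactivated : ∀ n i {t α} σ → length (queue (state i)) ≤ n →
    (t , α) ∈ queue (state i) → t ∈ ts → (∀ v → v ∈ varsOf (body t) → valueIn α v ≡ σ v) → Eventually (Deactivated t σ) i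
  queued-eventually-deactivated zero i σ ≤0 _ _ _ = ⊥-elim (queue-nonempty i ≤0)
  queued-eventually-deactivated (suc n) i {t} {α} σ ≤1+n queued t∈ α≗σ
    with ∈-++⁻ before (subst ((t , α) ∈_) split queued)
    where open FirstActive (fired (state i))
  ... | inj₁ in-before =
    now (inactive⇒inapplicable {α = α} σ t∈ α≗σ
           (All.lookup (FirstActive.before-inactive (fired (state i))) in-before))
  ... | inj₂ (here refl) = later (now λ app →
    proj₂ app (satisfied-after-firing t (All.lookup scoped t∈) (chaseSeq i) α≗σ))
  ... | inj₂ (there in-after) with requeue-cases _ (firedInvariant (state i)) (remaining i)
  ...   | inj₂ (_ , after-inactive) =
    later (now (inactive⇒inapplicable {α = α} σ t∈ α≗σ (All.lookup after-inactive in-after)))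
  ...   | inj₁ kept = later (queued-eventually-deactivated n (suc i) σ
    (subst (λ q → length q ≤ n) (sym kept) (remaining-shorter i n ≤1+n))
    (subst ((t , α) ∈_) (sym kept) in-after) t∈ α≗σ)

  eventually-deactivated : ∀ i t σ → t ∈ ts → Applicable (tgd t) σ (chaseSeq i) →
                           Eventually (Deactivated t σ) i
  eventually-deactivated i t σ t∈ app =
    let eventually k refilled = eventually-refilled _ i ≤-refl
        α , α∈ , α≗σ = triggers-complete t∈ (All.map (chaseSeq-mono i k) (proj₁ app))
        queued = subst ((t , α) ∈_) (sym refilled) α∈
    in laterBy k (queued-eventually-deactivated _ (i + k) σ ≤-refl queued t∈ α≗σ)

  infiniteChase : ∀ {_≺_} → InfiniteChase _≺_ (map tgd ts) F₀
  infiniteChase = record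
    { seq = chaseSeq ; sub = λ _ u → u ; start = refl ; step = chaseStep ; fair = fair }
    where
    fair : ∀ i r σ → r ∈ map tgd ts → Applicable r σ (chaseSeq i) →
           Σ ℕ λ n → ¬ Applicable r (λ v → accSub (λ _ u → u) i n (σ v)) (chaseSeq (i + n))
    fair i r σ r∈ app with ∈-map⁻ tgd r∈
    ... | t , t∈ , refl =
      let eventually k deactivated = eventually-deactivated i t σ t∈ app
      in k , deactivated ∘ applicable-cong t _ (λ v _ → accSub-id i k (σ v))

P : {A : Set} → A → A → Atom A
P x y = atom 0 (x ∷ y ∷ [])

EQ : {A : Set} → ℕ → A → A → Atom A
EQ e x y = atom e (x ∷ y ∷ [])

loop : List VAtom → TGD
loop β = mkTGD β (1 ∷ 2 ∷ []) (P 0 1 ∷ P 1 2 ∷ [])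

reflexiveLoop : TGD
reflexiveLoop = loop (P 0 0 ∷ [])

collapse : EGD
collapse = mkEGD (P 0 1 ∷ []) 0 1

exampleRules : List Rule
exampleRules = tgd reflexiveLoop ∷ egd collapse ∷ []

exampleRules-wellFormed : All WFRule exampleRules
exampleRules-wellFormed =
  ((_ , _ , refl) , (_ , _ , refl) , (λ _ → All.lookup (proj₁ scoped)) , (λ _ → All.lookup (proj₂ scoped)))
  ∷ ((_ , _ , refl) , here refl , there (here refl))
  ∷ []
  where
  scoped = wellScoped reflexiveLoop

Rep-con : ∀ {t s n v} → Rep t s (con n) v → (v ≡ s × t ≡ con n) ⊎ (v ≡ con n × t ≢ con n)
Rep-con here = inj₁ (refl , refl)
Rep-con (rcon t≢n) = inj₂ (refl , t≢n)

-- A merge of constants creates no term and deletes the replaced one for good.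
module ExampleTermination (_≺_ : Term → Term → Set) (irrefl : Irreflexive _≡_ _≺_)
  (F : FactSet) (db : IsDatabase F) (chase : InfiniteChase _≺_ exampleRules F) where
  open InfiniteChase chase

  record Merge (i : ℕ) : Set where
    field
      kept removed : Term
      kept≺removed : kept ≺ removed
      kept∈ : kept ∈ adom (seq i)
      removed∈ : removed ∈ adom (seq i)
      replaces : ∀ u → Rep removed kept u (sub i u)
      facts : seq (suc i) ≈ₛ map (mapAtom (sub i)) (seq i)

  merge : ∀ i → Merge i
  merge i with step i
  ... | _ , σ , here refl , (mi , unsat) , _ =
    ⊥-elim (unsat ((λ _ → σ 0) , (λ { _ (here refl) → refl ; _ (there (here refl)) → refl }) , m ∷ m ∷ []))
    where m = All.lookup mi (here refl)
  ... | _ , σ , there (here refl) , ((m ∷ []) , _) , (s , t , inj₁ (refl , refl) , s≺t , rep , eqs) =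
    record { kept = s ; removed = t ; kept≺removed = s≺t ; kept∈ = ∈-concatArgs⁺ (here refl) m
           ; removed∈ = ∈-concatArgs⁺ (there (here refl)) m ; replaces = rep ; facts = eqs }
  ... | _ , σ , there (here refl) , ((m ∷ []) , _) , (s , t , inj₂ (refl , refl) , s≺t , rep , eqs) =
    record { kept = s ; removed = t ; kept≺removed = s≺t ; kept∈ = ∈-concatArgs⁺ (there (here refl)) m
           ; removed∈ = ∈-concatArgs⁺ (here refl) m ; replaces = rep ; facts = eqs }

  removed : ℕ → Term
  removed i = Merge.removed (merge i)

  constant : ∀ {u} → u ∈ adom F → Σ ℕ λ n → u ≡ con n
  constant u∈ = let g , g∈ , u∈g = ∈-concatArgs⁻ F u∈ in All.lookup (All.lookup db g∈) u∈g

  shrinks : ∀ i → adom (seq i) ⊆ adom F →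
            ∀ {u} → u ∈ adom (seq (suc i)) → u ∈ adom (seq i) × u ≢ removed i
  shrinks i ⊆F u∈ with ∈-concatArgs⁻ (seq (suc i)) u∈
  ... | g , g∈ , u∈g with ∈-map⁻ (mapAtom (sub i)) (proj₁ (Merge.facts (merge i) g) g∈)
  ...   | atom q us , g′∈ , refl with ∈-map⁻ (sub i) u∈g
  ...     | u′ , u′∈ , refl with constant (⊆F (∈-concatArgs⁺ u′∈ g′∈))
  ...       | n , refl with Rep-con (Merge.replaces (merge i) (con n))
  ...         | inj₁ (≡kept , _) =
    subst (_∈ adom (seq i)) (sym ≡kept) (Merge.kept∈ (merge i)) ,
    λ ≡removed → irrefl (trans (sym ≡kept) ≡removed) (Merge.kept≺removed (merge i))
  ...         | inj₂ (≡con , removed≢) =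
    subst (_∈ adom (seq i)) (sym ≡con) (∈-concatArgs⁺ u′∈ g′∈) ,
    λ ≡removed → removed≢ (trans (sym ≡removed) ≡con)

  adom-⊆-initial : ∀ i → adom (seq i) ⊆ adom F
  adom-⊆-initial zero = subst (λ G → adom G ⊆ adom F) (sym start) (λ u∈ → u∈)
  adom-⊆-initial (suc i) u∈ = adom-⊆-initial i (proj₁ (shrinks i (adom-⊆-initial i) u∈))

  never-returns : ∀ {i j} → i < j → removed i ∉ adom (seq j)
  never-returns {i} {suc j} (s≤s i≤j) r∈ with m≤n⇒m<n∨m≡n i≤j
  ... | inj₁ i<j = never-returns i<j (proj₁ (shrinks j (adom-⊆-initial j) r∈))
  ... | inj₂ refl = proj₂ (shrinks i (adom-⊆-initial i) r∈) refl

  removed-injective : ∀ {i j} → i < j → removed i ≢ removed j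
  removed-injective {j = j} i<j same =
    never-returns i<j (subst (_∈ adom (seq j)) (sym same) (Merge.removed∈ (merge j)))

  removed∈initial : ∀ i → removed i ∈ adom F
  removed∈initial i = adom-⊆-initial i (Merge.removed∈ (merge i))

  impossible : ⊥
  impossible =
    let i , j , i<j , same-index = pigeonhole (n<1+n (length (adom F))) (Any.index ∘ removed∈initial ∘ toℕ)
    in removed-injective i<j (trans (lookup-index (removed∈initial (toℕ i)))
         (trans (cong (lookup (adom F)) same-index) (sym (lookup-index (removed∈initial (toℕ j))))))

exampleRules-terminate : ∀ _≺_ → Irreflexive _≡_ _≺_ → Terminates _≺_ exampleRules
exampleRules-terminate _≺_ irrefl F db chase = ExampleTermination.impossible _≺_ irrefl F db chase

-- The fresh variable is 3 + g, since 0, 1 and 2 occur in reflexiveLoop.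
keepFirst keepSecond : ℕ → ℕ → List VAtom
keepFirst e g = P 0 (3 + g) ∷ EQ e 0 (3 + g) ∷ []
keepSecond e g = P (3 + g) 0 ∷ EQ e 0 (3 + g) ∷ []

fresh-variable : ∀ {f} → f ∉ ruleVars (tgd reflexiveLoop) → Σ ℕ λ g → f ≡ 3 + g
fresh-variable {zero} f∉ = ⊥-elim (f∉ (here refl))
fresh-variable {1} f∉ = ⊥-elim (f∉ (there (there (here refl))))
fresh-variable {2} f∉ = ⊥-elim (f∉ (there (there (there (here refl)))))
fresh-variable {suc (suc (suc g))} _ = g , refl

keepFirst-shape : ∀ e {f} → f ∉ ruleVars (tgd reflexiveLoop) →
                  Σ ℕ λ g → P 0 f ∷ eqAtoms e ((0 , f) ∷ []) ≡ keepFirst e g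
keepFirst-shape e f∉ with fresh-variable f∉
... | g , refl = g , refl

keepSecond-shape : ∀ e {f} → f ∉ ruleVars (tgd reflexiveLoop) →
                   Σ ℕ λ g → P f 0 ∷ eqAtoms e ((0 , f) ∷ (0 , 0) ∷ []) ≡ keepSecond e g
keepSecond-shape e f∉ with fresh-variable f∉
... | g , refl = g , refl

sing-reflexiveLoop : ∀ e β′ → SingBody e (ruleVars (tgd reflexiveLoop)) (P 0 0 ∷ []) β′ →
                     Σ ℕ λ g → β′ ≡ keepFirst e g ⊎ β′ ≡ keepSecond e g
sing-reflexiveLoop e _
  (atom _ (x₁ ∷ x₂ ∷ []) ∷ [] , (refl , refl) ∷ [] , kept₁ ∷ kept₂ ∷ [] , (x₁≢x₂ ∷ []) ∷ _ , covers , refl)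
  with kept₁ | kept₂ | covers 0 (here refl)
... | inj₁ refl | inj₁ refl | _ = ⊥-elim (x₁≢x₂ refl)
... | inj₁ refl | inj₂ x₂∉ | _ = let g , shape = keepFirst-shape e x₂∉ in g , inj₁ shape
... | inj₂ x₁∉ | inj₁ refl | _ = let g , shape = keepSecond-shape e x₁∉ in g , inj₂ shape
... | inj₂ x₁∉ | inj₂ _ | here refl = ⊥-elim (x₁∉ (here refl))
... | inj₂ _ | inj₂ x₂∉ | there (here refl) = ⊥-elim (x₂∉ (here refl))

sing-collapse : ∀ e β′ → SingBody e (ruleVars (egd collapse)) (P 0 1 ∷ []) β′ → β′ ≡ P 0 1 ∷ []
sing-collapse e _
  (atom _ (x₁ ∷ x₂ ∷ []) ∷ [] , (refl , refl) ∷ [] , kept₁ ∷ kept₂ ∷ [] , _ , covers , refl)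
  with kept₁ | kept₂ | covers 0 (here refl) | covers 1 (there (here refl))
... | inj₁ refl | inj₁ refl | _ | _ = refl
... | inj₂ x₁∉ | _ | here refl | _ = ⊥-elim (x₁∉ (here refl))
... | _ | inj₂ x₂∉ | there (here refl) | _ = ⊥-elim (x₂∉ (here refl))
... | _ | inj₂ x₂∉ | _ | there (here refl) = ⊥-elim (x₂∉ (there (here refl)))
... | inj₁ refl | _ | _ | here ()
... | _ | inj₁ refl | there (here ()) | _

collapseEQ reflEQ symEQ transEQ : ℕ → TGD
collapseEQ e = mkTGD (P 0 1 ∷ []) [] (EQ e 0 1 ∷ [])
reflEQ e = mkTGD (P 0 1 ∷ []) [] (EQ e 0 0 ∷ EQ e 1 1 ∷ [])
symEQ e = mkTGD (EQ e 0 1 ∷ []) [] (EQ e 1 0 ∷ [])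
transEQ e = mkTGD (EQ e 0 1 ∷ EQ e 1 2 ∷ []) [] (EQ e 0 2 ∷ [])

-- reflEQ occurs once for each of the four occurrences of P in exampleRules.
eqRules : ℕ → List TGD
eqRules e = collapseEQ e ∷ reflEQ e ∷ reflEQ e ∷ reflEQ e ∷ reflEQ e ∷ symEQ e ∷ transEQ e ∷ []

eqRules-scoped : ∀ e → All WellScoped (eqRules e)
eqRules-scoped e = wellScoped (collapseEQ e)
  ∷ wellScoped (reflEQ e) ∷ wellScoped (reflEQ e) ∷ wellScoped (reflEQ e) ∷ wellScoped (reflEQ e)
  ∷ wellScoped (symEQ e) ∷ wellScoped (transEQ e) ∷ []

singRules : ℕ → List VAtom → List TGD
singRules e β = loop β ∷ eqRules e

Sing-exampleRules : ∀ e S → IsSing e exampleRules S →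
  Σ ℕ λ g → S ≡ map tgd (singRules e (keepFirst e g)) ⊎ S ≡ map tgd (singRules e (keepSecond e g))
Sing-exampleRules e _ (_ , (β′ , sing , refl) ∷ (β″ , sing″ , refl) ∷ [] , refl)
  with sing-collapse e β″ sing″ | sing-reflexiveLoop e β′ sing
... | refl | g , inj₁ refl = g , inj₁ refl
... | refl | g , inj₂ refl = g , inj₂ refl

a b : Term
a = con 0
b = con 1

seed : FactSet
seed = P a b ∷ []

seed-isDatabase : IsDatabase seed
seed-isDatabase = ((0 , refl) ∷ (1 , refl) ∷ []) ∷ []

produced-adom-⊆ : ∀ t {σ F} → WellScoped t → exs t ≡ [] → MapsInto σ (body t) F →
                  adom (produced t σ) ⊆ adom F
produced-adom-⊆ t {σ} {F} ws no-exs mi u∈ with ∈-concatArgs⁻ (produced t σ) u∈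
... | _ , g∈ , u∈g with ∈-map⁻ (mapAtom (skolemExt t σ)) g∈
...   | atom q vs , a∈ , refl with ∈-map⁻ (skolemExt t σ) u∈g
...     | v , v∈ , refl with All.lookup (proj₂ ws) (∈-concatArgs⁺ v∈ a∈)
...       | inj₁ vb = subst (_∈ adom F) (sym (skolemExt-body ws σ vb)) (image∈adom mi vb)
...       | inj₂ ve with subst (v ∈_) no-exs ve
...         | ()

depth≤depthL : ∀ {u} us → u ∈ us → depth u ≤ depthL us
depth≤depthL (u ∷ us) (here refl) = m≤m⊔n (depth u) (depthL us)
depth≤depthL (u ∷ us) (there u∈) = ≤-trans (depth≤depthL us u∈) (m≤n⊔m (depth u) (depthL us))

depth-sk : ∀ r w t → depth (sk r w (t ∷ [])) ≡ suc (depth t)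
depth-sk r w t = cong suc (⊔-identityʳ (depth t))

boundary : (Q : ℕ → Set) → Decidable Q → Q 0 → ∀ n → ¬ Q n → Σ ℕ λ k → Q k × ¬ Q (suc k)
boundary Q Q? q₀ zero ¬qₙ = ⊥-elim (¬qₙ q₀)
boundary Q Q? q₀ (suc n) ¬qₙ₊₁ with Q? n
... | yes qₙ = n , qₙ , ¬qₙ₊₁
... | no ¬qₙ = boundary Q Q? q₀ n ¬qₙ

chain-leaves-adom : (c : ℕ → Term) → (∀ k → depth (c k) ≡ k) → ∀ F → c 0 ∈ adom F →
                    Σ ℕ λ k → c k ∈ adom F × c (suc k) ∉ adom F
chain-leaves-adom c depth-c F c₀∈ =
  boundary (λ k → c k ∈ adom F) (λ k → c k ∈Term? adom F) c₀∈ (suc (depthL (adom F)))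
    (λ c∈ → 1+n≰n (subst (_≤ depthL (adom F)) (depth-c _) (depth≤depthL (adom F) c∈)))

pair : Term → Term → Subst
pair s t zero = s
pair s t (suc _) = t

-- U over-approximates the terms at which the loop fires.
module SingularChase (e : ℕ) (e≢0 : e ≢ 0) (β : List VAtom) (U : Term → Set) where

  T : TGD
  T = loop β

  y[_] z[_] : Term → Term
  y[ t ] = sk T 1 (t ∷ [])
  z[ t ] = sk T 2 (t ∷ [])

  data Expected : Fact → Set where
    eq-fact : ∀ {g} → pred g ≡ e → Expected g
    seed-fact : Expected (P a b)
    y-fact : ∀ {r} → U r → Expected (P r y[ r ])
    z-fact : ∀ {r} → U r → Expected (P y[ r ] z[ r ])

  SkolemClosed : FactSet → Set
  SkolemClosed F = ∀ t → y[ t ] ∈ adom F ⊎ z[ t ] ∈ adom F → P t y[ t ] ∈ F × P y[ t ] z[ t ] ∈ F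

  record Invariant (F : FactSet) : Set where
    field
      seed∈ : P a b ∈ F
      expected : ∀ {g} → g ∈ F → Expected g
      closed : SkolemClosed F

  invariant-seed : Invariant seed
  invariant-seed = record
    { seed∈ = here refl
    ; expected = λ { (here refl) → seed-fact }
    ; closed = λ _ → ⊥-elim ∘ Sum.[ no-sk , no-sk ] }
    where
    no-sk : ∀ {r w ts} → sk r w ts ∉ adom seed
    no-sk (here ())
    no-sk (there (here ()))

  closed-++ : ∀ F G → SkolemClosed F → adom G ⊆ adom F → SkolemClosed (F ++ G)
  closed-++ F G closed G⊆F t side =
    let y∈ , z∈ = closed t (Sum.map into-F into-F side) in ∈-++⁺ˡ y∈ , ∈-++⁺ˡ z∈
    where
    into-F : adom (F ++ G) ⊆ adom F
    into-F u∈ = Sum.[ (λ u∈F → u∈F) , G⊆F ] (adom-++⁻ F G u∈)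

  eqRule-preserves : ∀ t → WellScoped t → exs t ≡ [] → All (λ atm → pred atm ≡ e) (head t) →
                     Preserves Invariant t
  eqRule-preserves t ws no-exs head-EQ F σ inv (mi , _) = record
    { seed∈ = ∈-++⁺ˡ seed∈
    ; expected = λ g∈ → Sum.[ expected , new-fact ] (∈-++⁻ F g∈)
    ; closed = closed-++ F (produced t σ) closed (produced-adom-⊆ t ws no-exs mi) }
    where
    open Invariant inv
    new-fact : ∀ {g} → g ∈ produced t σ → Expected g
    new-fact g∈ with ∈-map⁻ (mapAtom (skolemExt t σ)) g∈
    ... | atom _ _ , a∈ , refl = eq-fact (All.lookup head-EQ a∈)

  RootsInU : Set
  RootsInU = ∀ {σ F} → Invariant F → MapsInto σ β F → U (σ 0)

  closed-after-loop : ∀ σ F → σ 0 ∈ adom F → SkolemClosed F → SkolemClosed (F ++ produced T σ)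
  closed-after-loop σ F root∈ closed t side =
    from-origin t (Sum.[ Sum.map₁ inj₁ ∘ origin 1 t , Sum.map₁ inj₂ ∘ origin 2 t ] side)
    where
    origin : ∀ w t → sk T w (t ∷ []) ∈ adom (F ++ produced T σ) →
             sk T w (t ∷ []) ∈ adom F ⊎ t ≡ σ 0
    origin w t u∈ with adom-++⁻ F (produced T σ) u∈
    ... | inj₁ old = inj₁ old
    ... | inj₂ (here u≡root) = inj₁ (subst (_∈ adom F) (sym u≡root) root∈)
    ... | inj₂ (there (here refl)) = inj₂ refl
    ... | inj₂ (there (there (here refl))) = inj₂ refl
    ... | inj₂ (there (there (there (here refl)))) = inj₂ refl
    from-origin : ∀ t → (y[ t ] ∈ adom F ⊎ z[ t ] ∈ adom F) ⊎ t ≡ σ 0 →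
                  P t y[ t ] ∈ F ++ produced T σ × P y[ t ] z[ t ] ∈ F ++ produced T σ
    from-origin t (inj₁ old) = let y∈ , z∈ = closed t old in ∈-++⁺ˡ y∈ , ∈-++⁺ˡ z∈
    from-origin _ (inj₂ refl) = ∈-++⁺ʳ F (here refl) , ∈-++⁺ʳ F (there (here refl))

  loop-preserves : WellScoped T → RootsInU → Preserves Invariant T
  loop-preserves ws roots F σ inv (mi , _) = record
    { seed∈ = ∈-++⁺ˡ seed∈
    ; expected = λ g∈ → Sum.[ expected , new-fact ] (∈-++⁻ F g∈)
    ; closed = closed-after-loop σ F root∈ closed }
    where
    open Invariant inv
    root∈ : σ 0 ∈ adom F
    root∈ with All.lookup (proj₂ ws) (here refl)
    ... | inj₁ 0∈β = image∈adom mi 0∈β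
    ... | inj₂ (here ())
    ... | inj₂ (there (here ()))
    new-fact : ∀ {g} → g ∈ produced T σ → Expected g
    new-fact (here refl) = y-fact (roots inv mi)
    new-fact (there (here refl)) = z-fact (roots inv mi)

  eqRules-preserve : All (Preserves Invariant) (eqRules e)
  eqRules-preserve = eqRule-preserves (collapseEQ e) (wellScoped (collapseEQ e)) refl (refl ∷ [])
    ∷ reflRule-preserves ∷ reflRule-preserves ∷ reflRule-preserves ∷ reflRule-preserves
    ∷ eqRule-preserves (symEQ e) (wellScoped (symEQ e)) refl (refl ∷ [])
    ∷ eqRule-preserves (transEQ e) (wellScoped (transEQ e)) refl (refl ∷ [])
    ∷ []
    where
    reflRule-preserves = eqRule-preserves (reflEQ e) (wellScoped (reflEQ e)) refl (refl ∷ refl ∷ [])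

  diverges : WellScoped T → RootsInU → (∀ F → Invariant F → ActiveTrigger (singRules e β) F) →
             ∀ {_≺_} → InfiniteChase _≺_ (map tgd (singRules e β)) seed
  diverges ws roots progress = FairChase.infiniteChase (singRules e β) (ws ∷ eqRules-scoped e) Invariant
    (loop-preserves ws roots ∷ eqRules-preserve) progress seed invariant-seed

  collapseEQ-active : ∀ {F s t} → P s t ∈ F → EQ e s t ∉ F → ActiveTrigger (singRules e β) F
  collapseEQ-active {F} p∈ eq∉ = collapseEQ e , pair _ _ , there (here refl) , (p∈ ∷ []) ,
    λ { (σ′ , agrees , (eq∈ ∷ [])) →
      eq∉ (subst₂ (λ x y → EQ e x y ∈ F) (agrees 0 (here refl)) (agrees 1 (there (here refl))) eq∈) }

  symEQ-active : ∀ {F s t} → EQ e s t ∈ F → EQ e t s ∉ F → ActiveTrigger (singRules e β) F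
  symEQ-active {F} eq∈ eq∉ = symEQ e , pair _ _ , there (there (there (there (there (there (here refl)))))) ,
    (eq∈ ∷ []) ,
    λ { (σ′ , agrees , (eq′∈ ∷ [])) →
      eq∉ (subst₂ (λ x y → EQ e x y ∈ F) (agrees 1 (there (here refl))) (agrees 0 (here refl)) eq′∈) }

  0≢e : 0 ≢ e
  0≢e = e≢0 ∘ sym

module KeepFirst (e g : ℕ) (e≢0 : e ≢ 0) where

  β : List VAtom
  β = keepFirst e g

  chain : ℕ → Term
  chain zero = a
  chain (suc k) = sk (loop β) 1 (chain k ∷ [])

  InChain : Term → Set
  InChain t = Σ ℕ λ k → t ≡ chain k

  open SingularChase e e≢0 β InChain

  depth-chain : ∀ k → depth (chain k) ≡ k
  depth-chain zero = refl
  depth-chain (suc k) = trans (depth-sk (loop β) 1 (chain k)) (cong suc (depth-chain k))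

  b∉chain : ∀ k → b ≢ chain k
  b∉chain zero ()
  b∉chain (suc k) ()

  z∉chain : ∀ {r} k → z[ r ] ≢ chain k
  z∉chain zero ()
  z∉chain (suc k) ()

  roots : RootsInU
  roots inv (p∈ ∷ _) = root (Invariant.expected inv p∈)
    where
    root : ∀ {s t} → Expected (P s t) → InChain s
    root (eq-fact 0≡e) = ⊥-elim (0≢e 0≡e)
    root seed-fact = 0 , refl
    root (y-fact in-chain) = in-chain
    root (z-fact (k , refl)) = suc k , refl

  -- A head match P(chain k, y), P(y, z) forces y = chain (k + 1).
  head-unmatched : ∀ F → Invariant F → ∀ k → chain (suc k) ∉ adom F →
                   ∀ {s y z} → s ≡ chain k → P s y ∈ F → P y z ∈ F → ⊥
  head-unmatched F inv k next∉ s≡ p₁∈ p₂∈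
    with Invariant.expected inv p₁∈ | Invariant.expected inv p₂∈
  ... | eq-fact 0≡e | _ = 0≢e 0≡e
  ... | _ | eq-fact 0≡e = 0≢e 0≡e
  ... | seed-fact | y-fact (j , b≡) = b∉chain j b≡
  ... | y-fact _ | _ = next∉ (subst (_∈ adom F) (cong y[_] s≡) (∈-concatArgs⁺ (here refl) p₂∈))
  ... | z-fact _ | y-fact (j , z≡) = z∉chain j z≡

  progress : ∀ F → Invariant F → ActiveTrigger (singRules e β) F
  progress F inv with chain-leaves-adom chain depth-chain F (∈-concatArgs⁺ (here refl) (Invariant.seed∈ inv))
  ... | k , here∈ , next∉ with body-fact k here∈
    where
    body-fact : ∀ k → chain k ∈ adom F → Σ Term λ w → P (chain k) w ∈ F
    body-fact zero _ = b , Invariant.seed∈ inv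
    body-fact (suc j) c∈ = z[ chain j ] , proj₂ (Invariant.closed inv (chain j) (inj₁ c∈))
  ...   | w , p∈ with EQ e (chain k) w ∈Fact? F
  ...     | no eq∉ = collapseEQ-active p∈ eq∉
  ...     | yes eq∈ = T , pair (chain k) w , here refl , (p∈ ∷ eq∈ ∷ []) ,
    λ { (_ , agrees , (p₁∈ ∷ p₂∈ ∷ [])) → head-unmatched F inv k next∉ (agrees 0 (here refl)) p₁∈ p₂∈ }

  diverges-keepFirst : ∀ {_≺_} → InfiniteChase _≺_ (map tgd (singRules e β)) seed
  diverges-keepFirst = diverges (wellScoped T) roots progress

module KeepSecond (e g : ℕ) (e≢0 : e ≢ 0) where

  β : List VAtom
  β = keepSecond e g

  open SingularChase e e≢0 β (λ _ → ⊤)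

  chain : ℕ → Term
  chain zero = b
  chain (suc k) = z[ chain k ]

  depth-chain : ∀ k → depth (chain k) ≡ k
  depth-chain zero = refl
  depth-chain (suc k) = trans (depth-sk T 2 (chain k)) (cong suc (depth-chain k))

  a∉chain : ∀ k → a ≢ chain k
  a∉chain zero ()
  a∉chain (suc k) ()

  y∉chain : ∀ {r} k → y[ r ] ≢ chain k
  y∉chain zero ()
  y∉chain (suc k) ()

  -- A head match P(chain k, y) forces y = y[chain k], whose z-successor is chain (k + 1).
  head-unmatched : ∀ F → Invariant F → ∀ k → chain (suc k) ∉ adom F →
                   ∀ {s y} → s ≡ chain k → P s y ∈ F → ⊥
  head-unmatched F inv k next∉ s≡ p∈ with Invariant.expected inv p∈
  ... | eq-fact 0≡e = 0≢e 0≡e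
  ... | seed-fact = a∉chain k s≡
  ... | z-fact _ = y∉chain k s≡
  ... | y-fact {r} _ =
    let second∈ = proj₂ (Invariant.closed inv r (inj₁ (∈-concatArgs⁺ (there (here refl)) p∈)))
    in next∉ (subst (_∈ adom F) (cong z[_] s≡) (∈-concatArgs⁺ (there (here refl)) second∈))

  progress : ∀ F → Invariant F → ActiveTrigger (singRules e β) F
  progress F inv
    with chain-leaves-adom chain depth-chain F (∈-concatArgs⁺ (there (here refl)) (Invariant.seed∈ inv))
  ... | k , here∈ , next∉ with body-fact k here∈
    where
    body-fact : ∀ k → chain k ∈ adom F → Σ Term λ p → P p (chain k) ∈ F
    body-fact zero _ = a , Invariant.seed∈ inv
    body-fact (suc j) c∈ = y[ chain j ] , proj₂ (Invariant.closed inv (chain j) (inj₂ c∈))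
  ...   | p , p∈ with EQ e p (chain k) ∈Fact? F | EQ e (chain k) p ∈Fact? F
  ...     | no eq∉ | _ = collapseEQ-active p∈ eq∉
  ...     | yes eq∈ | no eq∉ = symEQ-active eq∈ eq∉
  ...     | yes _ | yes eq∈ = T , pair (chain k) p , here refl , (p∈ ∷ eq∈ ∷ []) ,
    λ { (_ , agrees , (p₁∈ ∷ _)) → head-unmatched F inv k next∉ (agrees 0 (there (here refl))) p₁∈ }

  diverges-keepSecond : ∀ {_≺_} → InfiniteChase _≺_ (map tgd (singRules e β)) seed
  diverges-keepSecond = diverges (wellScoped T) (λ _ _ → tt) progress

Sing-exampleRules-diverge : ∀ {_≺_} e → e ≢ 0 → ∀ S → IsSing e exampleRules S →
                            InfiniteChase _≺_ S seed
Sing-exampleRules-diverge e e≢0 S sing with Sing-exampleRules e S sing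
... | g , inj₁ refl = KeepFirst.diverges-keepFirst e g e≢0
... | g , inj₂ refl = KeepSecond.diverges-keepSecond e g e≢0

freshEQ⇒e≢0 : ∀ {e} → FreshEQ e exampleRules → e ≢ 0
freshEQ⇒e≢0 fresh e≡0 = fresh (tgd reflexiveLoop) (here refl) (P 0 0) (here refl) (sym e≡0 , refl)

theorem4 : (_≺_ : Term → Term → Set) → IsStrictTotalOrder _≡_ _≺_ → DepthCompatible _≺_ →
           Σ (List Rule) λ R → All WFRule R × Terminates _≺_ R
             × (∀ e → FreshEQ e R → ∀ S → IsSing e R S → ¬ Terminates _≺_ S)
theorem4 _≺_ ≺-sto _ =
  exampleRules , exampleRules-wellFormed , exampleRules-terminate _≺_ (IsStrictTotalOrder.irrefl ≺-sto) ,
  λ e fresh S sing terminates →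
    terminates seed seed-isDatabase (Sing-exampleRules-diverge e (freshEQ⇒e≢0 fresh) S sing)
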